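{- Let $t\ge1$ and let $F$ be a family of sets with $|A\cap B|\le1$ for all distinct $A,B\in F$ and with the $t$-property. Suppose $x,y,z$ are elements with $|G_x|=|G_y|=|G_z|=t$ and $G_x,G_y,G_z$ pairwise disjoint. Then for every $A\in F$ and every representation $X$ of $A$, either $\{x,y,z\}\subseteq X$ or $\{x,y,z\}\cap X=\emptyset$.
   Context: A family of sets is a set $F$ of sets. A set $X$ with $|X|\le t$ is a $t$-transversal of $F$ if it meets every member of $F$. $F$ has the $t$-property if for every $A\in F$ the family $F\setminus\{A\}$ has a $t$-transversal $X$ with $X\cap A=\emptyset$; such an $X$ is a representation of $A$. $G_x=\{A\in F: x\in A\}$. -}

module Defs where

open import Data.Nat using (ℕ; _≤_)
open import Data.Fin using (Fin)
open import Data.Fin.Subset using (Subset; _∈_; _∉_; _∩_; ∣_∣)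
open import Data.Fin.Subset.Properties using (_∈?_)
open import Data.List using (List; filter; length)
open import Data.List.Relation.Unary.Unique.Propositional using (Unique)
import Data.List.Membership.Propositional as LM
open import Data.Product using (Σ; _×_; ∃)
open import Data.Empty using (⊥)
open import Relation.Binary.PropositionalEquality using (_≡_; _≢_)

record Family (n : ℕ) : Set where
  constructor family
  field
    members : List (Subset n)
    unique  : Unique members
open Family public

_∈F_ : ∀ {n} → Subset n → Family n → Set
A ∈F F = A LM.∈ members F

Meets : ∀ {n} → Subset n → Subset n → Set
Meets X B = ∃ λ u → u ∈ X × u ∈ B

IsRepresentation : ∀ {n} → ℕ → Family n → Subset n → Subset n → Set
IsRepresentation t F A X =
  ∣ X ∣ ≤ t
  × (∀ u → u ∈ X → u ∈ A → ⊥)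
  × (∀ B → B ∈F F → B ≢ A → Meets X B)

HasTProperty : ∀ {n} → ℕ → Family n → Set
HasTProperty t F = ∀ A → A ∈F F → ∃ λ X → IsRepresentation t F A X

Linear : ∀ {n} → Family n → Set
Linear F = ∀ A B → A ∈F F → B ∈F F → A ≢ B → ∣ A ∩ B ∣ ≤ 1

G : ∀ {n} → Fin n → Family n → List (Subset n)
G x F = filter (x ∈?_) (members F)

DisjointFam : ∀ {n} → List (Subset n) → List (Subset n) → Set
DisjointFam P Q = ∀ A → A LM.∈ P → A LM.∈ Q → ⊥

module Submission where

-- Fix A ∈ F and a representation X of A.  Suppose w ∉ X.  Any two
-- members of G_w meet only in w (linearity), so the members of G_w other than A
-- are pairwise disjoint inside X; each of them meets X (X represents A).  If
-- moreover E ⊆ X consists of points s with G_s ∩ G_w = ∅, no member of G_w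
-- touches E, so X contains E together with one private point from every member
-- of G_w ∖ {A}:   |G_w ∖ {A}| + |E| ≤ |X| ≤ t          (pencil bound).
-- Since |G_w ∖ {A}| ≥ t - 1, and = t when w ∉ A, this excludes
--   * two of x, y, z in X and the third outside (take |E| = 2), and
--   * one in X and two outside: A lies in at most one of the disjoint pencils of
--     the two outside points, so one of them, w, has w ∉ A (take |E| = 1).

open import Defs
open import Data.Nat using (ℕ; suc; _+_; _≤_; z≤n; s≤s)
open import Data.Nat.Properties using (≤-trans; ≤-reflexive; +-comm; +-monoʳ-≤)
import Data.Nat.Properties as ℕ
open import Data.Fin using (Fin) renaming (_≟_ to _≟ᶠ_)
open import Data.Fin.Subset using (Subset; _∈_; _∉_; _∪_; _-_; ∣_∣; _⊆_; ⁅_⁆)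
open import Data.Fin.Subset.Properties
  using (_∈?_; x∈p∩q⁺; x∈p∪q⁻; x∈p∪q⁺; x∈⁅x⁆; x∈⁅y⁆⇒x≡y; ∣⁅x⁆∣≡1;
         p⊆q⇒∣p∣≤∣q∣; p─q⊆p; x∈p∧x≢y⇒x∈p-y; x∈p⇒∣p-x∣<∣p∣)
open import Data.Vec.Properties using (≡-dec)
open import Data.Bool.Properties using () renaming (_≟_ to _≟ᵇ_)
open import Data.List using (List; []; _∷_; length; filter)
open import Data.List.Properties using (filter-all)
import Data.List.Relation.Unary.All as All
import Data.List.Relation.Unary.AllPairs as AllPairs
open AllPairs using (AllPairs; []; _∷_)
open import Data.List.Relation.Unary.Any using (here; there)
open import Data.List.Relation.Unary.Unique.Propositional using (Unique)
import Data.List.Relation.Unary.Unique.Propositional.Properties as Unique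
open import Data.List.Membership.Propositional using () renaming (_∈_ to _∈ˡ_)
open import Data.List.Membership.Propositional.Properties using (∈-filter⁻; ∈-filter⁺)
open import Data.Product using (_×_; _,_; proj₁; proj₂)
open import Data.Sum using (_⊎_; inj₁; inj₂)
open import Data.Empty using (⊥; ⊥-elim)
open import Relation.Nullary using (Dec; yes; no; ¬?)
open import Relation.Binary.PropositionalEquality using (_≡_; _≢_; refl; sym; trans; cong; cong₂; subst)

nonempty : ∀ {n} {S : Subset n} {u : Fin n} → u ∈ S → 1 ≤ ∣ S ∣
nonempty u∈S = ≤-trans (s≤s z≤n) (x∈p⇒∣p-x∣<∣p∣ u∈S)

two-points : ∀ {n} {S : Subset n} {u v : Fin n} → u ≢ v → u ∈ S → v ∈ S → 2 ≤ ∣ S ∣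
two-points u≢v u∈S v∈S =
  ≤-trans (s≤s (nonempty (x∈p∧x≢y⇒x∈p-y v∈S (λ v≡u → u≢v (sym v≡u))))) (x∈p⇒∣p-x∣<∣p∣ u∈S)

DisjointOn : ∀ {n} → Subset n → Subset n → Subset n → Set
DisjointOn Y B B' = ∀ {u} → u ∈ Y → u ∈ B → u ∈ B' → ⊥

-- Packing bound: sets that are pairwise disjoint inside Y, each meet Y and all
-- avoid E ⊆ Y, each own a private point of Y ∖ E; hence there are at most |Y| - |E|
-- of them.  Induction: delete from Y a point u of the first set.
packing : ∀ {n} (Y E : Subset n) (L : List (Subset n)) →
          AllPairs (DisjointOn Y) L →
          (∀ {B} → B ∈ˡ L → Meets Y B) →
          (∀ {B} → B ∈ˡ L → ∀ {s} → s ∈ E → s ∉ B) →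
          E ⊆ Y →
          length L + ∣ E ∣ ≤ ∣ Y ∣
packing Y E []      []           meets avoids E⊆Y = p⊆q⇒∣p∣≤∣q∣ E⊆Y
packing Y E (B ∷ L) (B#L ∷ L#L) meets avoids E⊆Y with meets (here refl)
... | u , u∈Y , u∈B =
  ≤-trans (s≤s (packing (Y - u) E L L#L' meets' avoids' E⊆Y-u)) (x∈p⇒∣p-x∣<∣p∣ u∈Y)
  where
  Y-u⊆Y : Y - u ⊆ Y
  Y-u⊆Y = p─q⊆p Y ⁅ u ⁆

  L#L' : AllPairs (DisjointOn (Y - u)) L
  L#L' = AllPairs.map (λ disj {v} v∈Y-u → disj (Y-u⊆Y v∈Y-u)) L#L

  -- a point of Y in another member B' differs from u, as B and B' are disjoint on Y
  meets' : ∀ {B'} → B' ∈ˡ L → Meets (Y - u) B'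
  meets' B'∈L with meets (there B'∈L)
  ... | v , v∈Y , v∈B' =
    v , x∈p∧x≢y⇒x∈p-y v∈Y (λ { refl → All.lookup B#L B'∈L u∈Y u∈B v∈B' }) , v∈B'

  avoids' : ∀ {B'} → B' ∈ˡ L → ∀ {s} → s ∈ E → s ∉ B'
  avoids' B'∈L = avoids (there B'∈L)

  E⊆Y-u : E ⊆ Y - u
  E⊆Y-u s∈E = x∈p∧x≢y⇒x∈p-y (E⊆Y s∈E) (λ { refl → avoids (here refl) s∈E u∈B })

_≟ˢ_ : ∀ {n} (A B : Subset n) → Dec (A ≡ B)
_≟ˢ_ = ≡-dec _≟ᵇ_

without : ∀ {n} → Subset n → List (Subset n) → List (Subset n)
without A = filter (λ B → ¬? (B ≟ˢ A))

length-without : ∀ {n} (A : Subset n) {L : List (Subset n)} → Unique L →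
                 length L ≤ suc (length (without A L))
length-without A {[]}    []            = z≤n
length-without A {B ∷ L} (B∉L ∷ uniq) with B ≟ˢ A
... | yes refl = s≤s (≤-reflexive (sym (cong length (filter-all _ L≢B))))
  where
  L≢B : All.All (_≢ B) L
  L≢B = All.map (λ B≢C C≡B → B≢C (sym C≡B)) B∉L
... | no  _    = s≤s (length-without A uniq)

unique⇒allPairs : ∀ {a r} {S : Set a} {R : S → S → Set r} {L : List S} → Unique L →
                  (∀ {B B'} → B ∈ˡ L → B' ∈ˡ L → B ≢ B' → R B B') → AllPairs R L
unique⇒allPairs []           related = []
unique⇒allPairs (B∉L ∷ uniq) related =
  All.tabulate (λ B'∈L → related (here refl) (there B'∈L) (All.lookup B∉L B'∈L))
  ∷ unique⇒allPairs uniq (λ B∈L B'∈L → related (there B∈L) (there B'∈L))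

disjoint-sym : ∀ {n} {P Q : List (Subset n)} → DisjointFam P Q → DisjointFam Q P
disjoint-sym P#Q B B∈Q B∈P = P#Q B B∈P B∈Q

module _ {n : ℕ} (F : Family n) where

  ∈G⁻ : ∀ {w B} → B ∈ˡ G w F → B ∈F F × w ∈ B
  ∈G⁻ {w} = ∈-filter⁻ (w ∈?_) {xs = members F}

  ∈G⁺ : ∀ {w B} → B ∈F F → w ∈ B → B ∈ˡ G w F
  ∈G⁺ {w} = ∈-filter⁺ (w ∈?_)

  disjoint-pencils : ∀ {s w B} → DisjointFam (G s F) (G w F) → B ∈ˡ G w F → s ∉ B
  disjoint-pencils disj B∈Gw s∈B = disj _ (∈G⁺ (proj₁ (∈G⁻ B∈Gw)) s∈B) B∈Gw

  distinct-points : ∀ {x y} → 1 ≤ length (G x F) → DisjointFam (G x F) (G y F) → x ≢ y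
  distinct-points {x} 1≤|Gx| disj refl with G x F | 1≤|Gx|
  ... | []    | ()
  ... | B ∷ _ | _  = disj B (here refl) (here refl)

  pencil-meet : Linear F → ∀ {w B B' u} → B ∈ˡ G w F → B' ∈ˡ G w F → B ≢ B' →
                u ∈ B → u ∈ B' → u ≡ w
  pencil-meet linear {w} {u = u} B∈Gw B'∈Gw B≢B' u∈B u∈B' with u ≟ᶠ w
  ... | yes u≡w = u≡w
  ... | no  u≢w =
    let (B∈F , w∈B) = ∈G⁻ B∈Gw ; (B'∈F , w∈B') = ∈G⁻ B'∈Gw in
    ⊥-elim (ℕ.<-irrefl refl (≤-trans (two-points u≢w (x∈p∩q⁺ (u∈B , u∈B')) (x∈p∩q⁺ (w∈B , w∈B')))
                                      (linear _ _ B∈F B'∈F B≢B')))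

module Representation {n t : ℕ} (F : Family n) (linear : Linear F) {A X : Subset n}
                      (rep : IsRepresentation t F A X) where

  others : Fin n → List (Subset n)
  others w = without A (G w F)

  others⁻ : ∀ {w B} → B ∈ˡ others w → B ∈ˡ G w F × B ≢ A
  others⁻ {w} = ∈-filter⁻ (λ B → ¬? (B ≟ˢ A)) {xs = G w F}

  pencil-bound : ∀ w (E : Subset n) → w ∉ X → E ⊆ X →
                 (∀ {s} → s ∈ E → DisjointFam (G s F) (G w F)) →
                 length (others w) + ∣ E ∣ ≤ t
  pencil-bound w E w∉X E⊆X disj =
    ≤-trans (packing X E (others w) pairwise meets avoids E⊆X) (proj₁ rep)
    where
    pairwise : AllPairs (DisjointOn X) (others w)
    pairwise = unique⇒allPairs (Unique.filter⁺ _ (Unique.filter⁺ _ (unique F)))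
      λ B∈ B'∈ B≢B' u∈X u∈B u∈B' →
        w∉X (subst (_∈ X) (pencil-meet F linear (proj₁ (others⁻ B∈)) (proj₁ (others⁻ B'∈)) B≢B' u∈B u∈B') u∈X)

    meets : ∀ {B} → B ∈ˡ others w → Meets X B
    meets B∈ = let (B∈Gw , B≢A) = others⁻ B∈ in proj₂ (proj₂ rep) _ (proj₁ (∈G⁻ F B∈Gw)) B≢A

    avoids : ∀ {B} → B ∈ˡ others w → ∀ {s} → s ∈ E → s ∉ B
    avoids B∈ s∈E = disjoint-pencils F (disj s∈E) (proj₁ (others⁻ B∈))

  others-length : ∀ w → length (G w F) ≤ suc (length (others w))
  others-length w = length-without A (Unique.filter⁺ _ (unique F))

  others-length-free : ∀ {w} → w ∉ A → length (others w) ≡ length (G w F)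
  others-length-free w∉A =
    cong length (filter-all _ (All.tabulate λ B∈Gw B≡A → w∉A (subst (_ ∈_) B≡A (proj₂ (∈G⁻ F B∈Gw)))))

  -- Two points of X whose pencils avoid the t-element pencil of a point w ∉ X
  -- are impossible:  t ≤ 1 + |G_w ∖ {A}| ≤ t - 1.
  two-inside-one-outside : ∀ {s₁ s₂ w} → s₁ ≢ s₂ → s₁ ∈ X → s₂ ∈ X → w ∉ X →
                           length (G w F) ≡ t →
                           DisjointFam (G s₁ F) (G w F) → DisjointFam (G s₂ F) (G w F) → ⊥
  two-inside-one-outside {s₁} {s₂} {w} s₁≢s₂ s₁∈X s₂∈X w∉X |Gw| s₁#w s₂#w =
    ℕ.<-irrefl refl (begin
      suc t                     ≤⟨ s≤s (subst (_≤ _) |Gw| (others-length w)) ⟩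
      2 + length (others w)     ≡⟨ +-comm 2 _ ⟩
      length (others w) + 2     ≤⟨ +-monoʳ-≤ _ 2≤|E| ⟩
      length (others w) + ∣ E ∣ ≤⟨ pencil-bound w E w∉X (pair-elim s₁∈X s₂∈X) (pair-elim s₁#w s₂#w) ⟩
      t                         ∎)
    where
    open ℕ.≤-Reasoning
    E : Subset n
    E = ⁅ s₁ ⁆ ∪ ⁅ s₂ ⁆
    2≤|E| : 2 ≤ ∣ E ∣
    2≤|E| = two-points s₁≢s₂ (x∈p∪q⁺ (inj₁ (x∈⁅x⁆ s₁))) (x∈p∪q⁺ (inj₂ (x∈⁅x⁆ s₂)))
    pair-elim : ∀ {P : Fin n → Set} → P s₁ → P s₂ → ∀ {s} → s ∈ E → P s
    pair-elim {P} P₁ P₂ s∈E with x∈p∪q⁻ ⁅ s₁ ⁆ ⁅ s₂ ⁆ s∈E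
    ... | inj₁ s∈⁅s₁⁆ = subst P (sym (x∈⁅y⁆⇒x≡y s₁ s∈⁅s₁⁆)) P₁
    ... | inj₂ s∈⁅s₂⁆ = subst P (sym (x∈⁅y⁆⇒x≡y s₂ s∈⁅s₂⁆)) P₂

  -- A point of X whose pencil avoids the t-element pencil of a point w ∉ X ∪ A
  -- is impossible:  t = |G_w ∖ {A}| ≤ t - 1.
  one-inside-one-free : ∀ {s w} → s ∈ X → w ∉ X → w ∉ A → length (G w F) ≡ t →
                        DisjointFam (G s F) (G w F) → ⊥
  one-inside-one-free {s} {w} s∈X w∉X w∉A |Gw| s#w =
    ℕ.<-irrefl refl (begin
      suc t                     ≡⟨ +-comm 1 t ⟩
      t + 1                     ≡⟨ cong₂ _+_ (sym (trans (others-length-free w∉A) |Gw|)) (sym (∣⁅x⁆∣≡1 s)) ⟩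
      length (others w) + ∣ ⁅ s ⁆ ∣ ≤⟨ pencil-bound w ⁅ s ⁆ w∉X (singleton-elim s∈X) (singleton-elim s#w) ⟩
      t                         ∎)
    where
    open ℕ.≤-Reasoning
    singleton-elim : ∀ {P : Fin n → Set} → P s → ∀ {s'} → s' ∈ ⁅ s ⁆ → P s'
    singleton-elim {P} Ps s'∈⁅s⁆ = subst P (sym (x∈⁅y⁆⇒x≡y s s'∈⁅s⁆)) Ps

  -- One point of X and two points outside X with pairwise disjoint t-element
  -- pencils are impossible: A lies in at most one of the two outside pencils.
  one-inside-two-outside : A ∈F F → ∀ {s w₁ w₂} → s ∈ X → w₁ ∉ X → w₂ ∉ X →
                           length (G w₁ F) ≡ t → length (G w₂ F) ≡ t →
                           DisjointFam (G s F) (G w₁ F) → DisjointFam (G s F) (G w₂ F) →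
                           DisjointFam (G w₁ F) (G w₂ F) → ⊥
  one-inside-two-outside A∈F {s} {w₁} {w₂} s∈X w₁∉X w₂∉X |Gw₁| |Gw₂| s#w₁ s#w₂ w₁#w₂
    with w₁ ∈? A | w₂ ∈? A
  ... | no w₁∉A | _       = one-inside-one-free s∈X w₁∉X w₁∉A |Gw₁| s#w₁
  ... | _       | no w₂∉A = one-inside-one-free s∈X w₂∉X w₂∉A |Gw₂| s#w₂
  ... | yes w₁∈A | yes w₂∈A = w₁#w₂ A (∈G⁺ F A∈F w₁∈A) (∈G⁺ F A∈F w₂∈A)

-- The
-- points are pairwise distinct since their pencils are disjoint and nonempty
-- (t ≥ 1); each mixed configuration is excluded by one of the lemmas above.
lemma12 : (n t : ℕ) → 1 ≤ t → (F : Family n) → Linear F → HasTProperty t F →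
    (x y z : Fin n) →
    length (G x F) ≡ t → length (G y F) ≡ t → length (G z F) ≡ t →
    DisjointFam (G x F) (G y F) → DisjointFam (G x F) (G z F) → DisjointFam (G y F) (G z F) →
    (A X : Subset n) → A ∈F F → IsRepresentation t F A X →
    (x ∈ X × y ∈ X × z ∈ X) ⊎ (x ∉ X × y ∉ X × z ∉ X)
lemma12 n t 1≤t F linear _ x y z |Gx| |Gy| |Gz| x#y x#z y#z A X A∈F rep =
  classify (x ∈? X) (y ∈? X) (z ∈? X)
  where
  open Representation F linear rep

  pencil-nonempty : ∀ {w} → length (G w F) ≡ t → 1 ≤ length (G w F)
  pencil-nonempty |Gw| = subst (1 ≤_) (sym |Gw|) 1≤t

  classify : Dec (x ∈ X) → Dec (y ∈ X) → Dec (z ∈ X) →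
             (x ∈ X × y ∈ X × z ∈ X) ⊎ (x ∉ X × y ∉ X × z ∉ X)
  classify (yes x∈X) (yes y∈X) (yes z∈X) = inj₁ (x∈X , y∈X , z∈X)
  classify (no  x∉X) (no  y∉X) (no  z∉X) = inj₂ (x∉X , y∉X , z∉X)
  classify (yes x∈X) (yes y∈X) (no  z∉X) = ⊥-elim (two-inside-one-outside
    (distinct-points F (pencil-nonempty |Gx|) x#y) x∈X y∈X z∉X |Gz| x#z y#z)
  classify (yes x∈X) (no  y∉X) (yes z∈X) = ⊥-elim (two-inside-one-outside
    (distinct-points F (pencil-nonempty |Gx|) x#z) x∈X z∈X y∉X |Gy| x#y (disjoint-sym y#z))
  classify (no  x∉X) (yes y∈X) (yes z∈X) = ⊥-elim (two-inside-one-outside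
    (distinct-points F (pencil-nonempty |Gy|) y#z) y∈X z∈X x∉X |Gx| (disjoint-sym x#y) (disjoint-sym x#z))
  classify (yes x∈X) (no  y∉X) (no  z∉X) = ⊥-elim (one-inside-two-outside A∈F
    x∈X y∉X z∉X |Gy| |Gz| x#y x#z y#z)
  classify (no  x∉X) (yes y∈X) (no  z∉X) = ⊥-elim (one-inside-two-outside A∈F
    y∈X x∉X z∉X |Gx| |Gz| (disjoint-sym x#y) y#z x#z)
  classify (no  x∉X) (no  y∉X) (yes z∈X) = ⊥-elim (one-inside-two-outside A∈F
    z∈X x∉X y∉X |Gx| |Gy| (disjoint-sym x#z) (disjoint-sym y#z) x#y)
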